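{- Let $\mapsto_1$ and $\mapsto_2$ be two PARS relations on the same set $A$, with associated relations $\twoheadrightarrow_1,\twoheadrightarrow_2$. If $\mapsto_1$ is simulated by $\mapsto_2$, then $\twoheadrightarrow_1\subseteq\twoheadrightarrow_2^*$. If moreover each of $\mapsto_1,\mapsto_2$ is simulated by the other, then $\twoheadrightarrow_1^*=\twoheadrightarrow_2^*$, and $(A,\mapsto_1)$ is distribution confluent if and only if $(A,\mapsto_2)$ is.
   Context: For a set $A$, $\mathrm{Dist}(A)$ is the set of finite lists of pairs $(p,a)$ with $p\in\mathbb{R}^+$ and $a\in A$; $[\,]$ empty list, $::$ cons, $++$ concatenation; $\mathrm{Dist}_1(A)$ the lists whose weights sum to $1$; $\alpha[(p_i,a_i)]_i=[(\alpha p_i,a_i)]_i$. A PARS is a pair $(A,\mapsto)$ with $\mapsto\subseteq A\times\mathrm{Dist}_1(A)$. The relation $\sim$ is the smallest relation on $\mathrm{Dist}(A)$ containing $[(p,a),(q,b)]\sim[(q,b),(p,a)]$, $[(p,a),(q,a)]\sim[(p+q,a)]$, $[(p+q,a)]\sim[(p,a),(q,a)]$ and closed under $D\sim D'\Rightarrow E_1++D++E_2\sim E_1++D'++E_2$; $\approx$ is its reflexive-transitive closure. For a PARS relation $\mapsto_i$, parallel evolution $\to_{P,i}$ is: $[\,]\to_{P,i}[\,]$; if $ds\to_{P,i}ds'$ then $(p,a)::ds\to_{P,i}(p,a)::ds'$; if $a\mapsto_i E$ and $ds\to_{P,i}ds'$ then $(p,a)::ds\to_{P,i}pE++ds'$;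 and $\twoheadrightarrow_i\;=\;\to_{P,i}\cup\approx$, with $^*$ denoting reflexive-transitive closure. $\mapsto_1$ is simulated by $\mapsto_2$ if for every $a\mapsto_1 D$ we have $[(1,a)]\twoheadrightarrow_2^*D$. $(A,\mapsto_i)$ is distribution confluent if $\twoheadrightarrow_i$ is confluent (every pair $E\twoheadleftarrow_i^*D\twoheadrightarrow_i^*F$ has $C$ with $E\twoheadrightarrow_i^*C\twoheadleftarrow_i^*F$). -}

module Defs where

open import Data.List using (List; []; _∷_; _++_; map)
open import Data.Product using (_×_; _,_; ∃-syntax)
open import Data.Sum using (_⊎_)
open import Relation.Binary.PropositionalEquality using (_≡_)
open import Relation.Binary.Construct.Closure.ReflexiveTransitive using (Star)

record Weights : Set₁ where
  infixl 6 _+_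
  infixl 7 _*_
  field
    Carrier     : Set
    _+_         : Carrier → Carrier → Carrier
    _*_         : Carrier → Carrier → Carrier
    1#          : Carrier
    +-assoc     : ∀ x y z → (x + y) + z ≡ x + (y + z)
    +-comm      : ∀ x y → x + y ≡ y + x
    *-assoc     : ∀ x y z → (x * y) * z ≡ x * (y * z)
    *-comm      : ∀ x y → x * y ≡ y * x
    *-identityˡ : ∀ x → 1# * x ≡ x
    *-identityʳ : ∀ x → x * 1# ≡ x
    distribˡ    : ∀ x y z → x * (y + z) ≡ (x * y) + (x * z)
    distribʳ    : ∀ x y z → (y + z) * x ≡ (y * x) + (z * x)

open Weights public using (Carrier)

module _ {W : Weights} where
  open Weights W hiding (Carrier)

  Dist : Set → Set
  Dist A = List (Carrier W × A)

  -- sum of weights (relational, since ℝ⁺ has no zero: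
  -- the empty list never sums to a positive weight)
  data SumsTo {A : Set} : Dist A → Carrier W → Set where
    one  : ∀ {p a} → SumsTo ((p , a) ∷ []) p
    cons : ∀ {p a ds s} → SumsTo ds s → SumsTo ((p , a) ∷ ds) (p + s)

  IsDist₁ : {A : Set} → Dist A → Set
  IsDist₁ D = SumsTo D 1#

  scale : {A : Set} → Carrier W → Dist A → Dist A
  scale α = map (λ { (p , a) → (α * p , a) })

  record PARS (A : Set) : Set₁ where
    field
      _↦_   : A → Dist A → Set
      dist₁ : ∀ {a E} → a ↦ E → IsDist₁ E

  data _∼_ {A : Set} : Dist A → Dist A → Set where
    swap  : ∀ {p a q b} → ((p , a) ∷ (q , b) ∷ []) ∼ ((q , b) ∷ (p , a) ∷ [])
    merge : ∀ {p q a} → ((p , a) ∷ (q , a) ∷ []) ∼ ((p + q , a) ∷ [])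
    split : ∀ {p q a} → ((p + q , a) ∷ []) ∼ ((p , a) ∷ (q , a) ∷ [])
    ctx   : ∀ {D D'} E₁ E₂ → D ∼ D' → (E₁ ++ D ++ E₂) ∼ (E₁ ++ D' ++ E₂)

  _≈_ : {A : Set} → Dist A → Dist A → Set
  _≈_ = Star _∼_

  data ParStep {A : Set} (R : PARS A) : Dist A → Dist A → Set where
    nil  : ParStep R [] []
    skip : ∀ {p a ds ds'} → ParStep R ds ds' →
           ParStep R ((p , a) ∷ ds) ((p , a) ∷ ds')
    step : ∀ {p a E ds ds'} → PARS._↦_ R a E → ParStep R ds ds' →
           ParStep R ((p , a) ∷ ds) (scale p E ++ ds')

  -- ↠ = →_P ∪ ≈
  Arrow : {A : Set} → PARS A → Dist A → Dist A → Set
  Arrow R D E = ParStep R D E ⊎ (D ≈ E)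

  Arrow* : {A : Set} → PARS A → Dist A → Dist A → Set
  Arrow* R = Star (Arrow R)

  SimulatedBy : {A : Set} → PARS A → PARS A → Set
  SimulatedBy R₁ R₂ = ∀ {a D} → PARS._↦_ R₁ a D → Arrow* R₂ ((1# , a) ∷ []) D

  DistributionConfluent : {A : Set} → PARS A → Set
  DistributionConfluent R = ∀ {D E F} → Arrow* R D E → Arrow* R D F →
    ∃[ C ] (Arrow* R E C × Arrow* R F C)

-- Under simulation, a single parallel step of ↦₁ is replayed by ↠₂*
-- element by element: an evolving element (p , a) with a ↦₁ E is simulated
-- by scaling the ↠₂*-derivation [(1 , a)] ↠₂* E by p, and ↠₂* is closed
-- under scaling and under list contexts, so these derivations can be run
-- one after another.  Mutual simulation then makes ↠₁* and ↠₂* the same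
-- relation, and confluence only depends on that relation.
module Submission where

open import Defs
open import Data.List using ([]; _∷_; _++_)
open import Data.List.Properties using (map-++; map-∘; map-cong; ++-assoc; ++-identityʳ)
open import Data.Product using (_×_; _,_)
open import Data.Sum using (inj₁; inj₂)
open import Function.Bundles using (_⇔_; mk⇔; Equivalence)
open import Function.Properties.Equivalence using () renaming (sym to ⇔-sym)
open import Relation.Binary.PropositionalEquality
  using (_≡_; sym; trans; cong; subst; subst₂)
open import Relation.Binary.Construct.Closure.ReflexiveTransitive
  using (ε; _◅_; _◅◅_; gmap; _⋆)

module _ {W : Weights} {A : Set} where
  open Weights W using (_*_; *-assoc; *-identityʳ; distribˡ)

  scale-++ : ∀ p (X Y : Dist {W} A) →
             scale {W} p (X ++ Y) ≡ scale {W} p X ++ scale {W} p Y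
  scale-++ p = map-++ _

  scale-scale : ∀ p q (X : Dist {W} A) →
                scale {W} p (scale {W} q X) ≡ scale {W} (p * q) X
  scale-scale p q X =
    trans (sym (map-∘ X)) (map-cong (λ { (r , a) → cong (_, a) (sym (*-assoc p q r)) }) X)

  ∼-scale : ∀ p {X Y : Dist {W} A} → _∼_ {W} X Y → _∼_ {W} (scale {W} p X) (scale {W} p Y)
  ∼-scale p swap = swap
  ∼-scale p (merge {q} {r} {a}) =
    subst (λ s → _∼_ {W} _ ((s , a) ∷ [])) (sym (distribˡ p q r)) merge
  ∼-scale p (split {q} {r} {a}) =
    subst (λ s → _∼_ {W} ((s , a) ∷ []) _) (sym (distribˡ p q r)) split
  ∼-scale p (ctx {D} {D′} E₁ E₂ D∼D′) =
    subst₂ (_∼_ {W}) (sym (scale-ctx D)) (sym (scale-ctx D′))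
      (ctx (scale {W} p E₁) (scale {W} p E₂) (∼-scale p D∼D′))
    where
    scale-ctx : ∀ X → scale {W} p (E₁ ++ X ++ E₂) ≡
                      scale {W} p E₁ ++ scale {W} p X ++ scale {W} p E₂
    scale-ctx X = trans (scale-++ p E₁ (X ++ E₂)) (cong (scale {W} p E₁ ++_) (scale-++ p X E₂))

  module _ (R : PARS {W} A) where

    ParStep-refl : ∀ (X : Dist {W} A) → ParStep R X X
    ParStep-refl []      = nil
    ParStep-refl (_ ∷ X) = skip (ParStep-refl X)

    ParStep-++ : ∀ {X X′ Y Y′ : Dist {W} A} →
                 ParStep R X X′ → ParStep R Y Y′ → ParStep R (X ++ Y) (X′ ++ Y′)
    ParStep-++ nil                   Y→Y′ = Y→Y′
    ParStep-++ (skip X→X′)           Y→Y′ = skip (ParStep-++ X→X′ Y→Y′)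
    ParStep-++ {Y′ = Y′} (step {p = p} {E = E} {ds' = X′} a↦E X→X′) Y→Y′ =
      subst (ParStep R _) (sym (++-assoc (scale {W} p E) X′ Y′))
        (step a↦E (ParStep-++ X→X′ Y→Y′))

    ParStep-scale : ∀ p {X Y : Dist {W} A} →
                    ParStep R X Y → ParStep R (scale {W} p X) (scale {W} p Y)
    ParStep-scale p nil          = nil
    ParStep-scale p (skip X→Y)   = skip (ParStep-scale p X→Y)
    ParStep-scale p (step {p = q} {E = E} {ds' = Y} a↦E X→Y) =
      subst (ParStep R _) (sym scale-evolved) (step a↦E (ParStep-scale p X→Y))
      where
      scale-evolved : scale {W} p (scale {W} q E ++ Y) ≡ scale {W} (p * q) E ++ scale {W} p Y
      scale-evolved = trans (scale-++ p (scale {W} q E) Y)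
                            (cong (_++ scale {W} p Y) (scale-scale p q E))

    Arrow-ctx : ∀ L M {X Y : Dist {W} A} →
                Arrow R X Y → Arrow R (L ++ X ++ M) (L ++ Y ++ M)
    Arrow-ctx L M (inj₁ X→Y) =
      inj₁ (ParStep-++ (ParStep-refl L) (ParStep-++ X→Y (ParStep-refl M)))
    Arrow-ctx L M (inj₂ X≈Y) = inj₂ (gmap (λ X → L ++ X ++ M) (ctx {W} L M) X≈Y)

    Arrow-scale : ∀ p {X Y : Dist {W} A} →
                  Arrow R X Y → Arrow R (scale {W} p X) (scale {W} p Y)
    Arrow-scale p (inj₁ X→Y) = inj₁ (ParStep-scale p X→Y)
    Arrow-scale p (inj₂ X≈Y) = inj₂ (gmap (scale {W} p) (∼-scale p) X≈Y)

    Arrow*-++ʳ : ∀ M {X Y : Dist {W} A} → Arrow* R X Y → Arrow* R (X ++ M) (Y ++ M)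
    Arrow*-++ʳ M = gmap _ (Arrow-ctx [] M)

    Arrow*-++ˡ : ∀ L {X Y : Dist {W} A} → Arrow* R X Y → Arrow* R (L ++ X) (L ++ Y)
    Arrow*-++ˡ L {X} {Y} X↠Y =
      subst₂ (Arrow* R) (cong (L ++_) (++-identityʳ X)) (cong (L ++_) (++-identityʳ Y))
        (gmap _ (Arrow-ctx L []) X↠Y)

    Arrow*-scale : ∀ p {X Y : Dist {W} A} →
                   Arrow* R X Y → Arrow* R (scale {W} p X) (scale {W} p Y)
    Arrow*-scale p = gmap _ (Arrow-scale p)

  module _ {R₁ R₂ : PARS {W} A} (R₁⊑R₂ : SimulatedBy R₁ R₂) where

    ParStep⇒Arrow* : ∀ {X Y : Dist {W} A} → ParStep R₁ X Y → Arrow* R₂ X Y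
    ParStep⇒Arrow* nil = ε
    ParStep⇒Arrow* (skip {p = p} {a = a} X→Y) =
      Arrow*-++ˡ R₂ ((p , a) ∷ []) (ParStep⇒Arrow* X→Y)
    ParStep⇒Arrow* (step {p = p} {a = a} {E = E} {ds = X} a↦E X→Y) =
      Arrow*-++ʳ R₂ X simulated ◅◅ Arrow*-++ˡ R₂ (scale {W} p E) (ParStep⇒Arrow* X→Y)
      where
      simulated : Arrow* R₂ ((p , a) ∷ []) (scale {W} p E)
      simulated = subst (λ q → Arrow* R₂ ((q , a) ∷ []) (scale {W} p E)) (*-identityʳ p)
                    (Arrow*-scale R₂ p (R₁⊑R₂ a↦E))

    Arrow⇒Arrow* : ∀ {X Y : Dist {W} A} → Arrow R₁ X Y → Arrow* R₂ X Y
    Arrow⇒Arrow* (inj₁ X→Y) = ParStep⇒Arrow* X→Y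
    Arrow⇒Arrow* (inj₂ X≈Y) = inj₂ X≈Y ◅ ε

  DistributionConfluent-resp : {R₁ R₂ : PARS {W} A} →
    (∀ {X Y} → Arrow* R₁ X Y ⇔ Arrow* R₂ X Y) →
    DistributionConfluent R₁ → DistributionConfluent R₂
  DistributionConfluent-resp R₁⇔R₂ confluent D↠E D↠F
    with confluent (Equivalence.from R₁⇔R₂ D↠E) (Equivalence.from R₁⇔R₂ D↠F)
  ... | C , E↠C , F↠C = C , Equivalence.to R₁⇔R₂ E↠C , Equivalence.to R₁⇔R₂ F↠C

lemma4p12 : (W : Weights) (A : Set) (R₁ R₂ : PARS {W} A)
    → (SimulatedBy R₁ R₂ → ∀ {D E} → Arrow R₁ D E → Arrow* R₂ D E)
    × (SimulatedBy R₁ R₂ → SimulatedBy R₂ R₁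
       → (∀ {D E} → Arrow* R₁ D E ⇔ Arrow* R₂ D E)
         × (DistributionConfluent R₁ ⇔ DistributionConfluent R₂))
lemma4p12 W A R₁ R₂ = Arrow⇒Arrow* , mutually-simulated
  where
  mutually-simulated : SimulatedBy R₁ R₂ → SimulatedBy R₂ R₁
         → (∀ {D E} → Arrow* R₁ D E ⇔ Arrow* R₂ D E)
           × (DistributionConfluent R₁ ⇔ DistributionConfluent R₂)
  mutually-simulated R₁⊑R₂ R₂⊑R₁ = same-closure ,
    mk⇔ (DistributionConfluent-resp same-closure)
        (DistributionConfluent-resp (⇔-sym same-closure))
    where
    same-closure : ∀ {D E} → Arrow* R₁ D E ⇔ Arrow* R₂ D E
    same-closure = mk⇔ (Arrow⇒Arrow* R₁⊑R₂ ⋆) (Arrow⇒Arrow* R₂⊑R₁ ⋆)
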